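{- Let $J$ be a graph, $t$ a non-negative integer, and $P_1,\dots,P_k$ paths in $J$ with $k>t\cdot\max_{i\in[k]}|V(P_i)|$ such that for any $i\neq j\in[k]$ and any $\ell\in[\min(|V(P_i)|,|V(P_j)|)-1]$, the $\ell$-th edge of $P_i$ and the $\ell$-th edge of $P_j$ form an induced matching of $J$. Then for any cut $(A,B)$ of $J$ with $\mathrm{sim}_J(A,B)\le t$, there exists $i\in[k]$ with $V(P_i)\subseteq A$ or $V(P_i)\subseteq B$.
   Context: Each path $P_i$ comes with a fixed ordering of its edges from one end to the other ("$\ell$-th edge"). A cut of $J$ is a bipartition $(A,B)$ of $V(J)$. For disjoint $X,Y\subseteq V(J)$, $\mathrm{sim}_J(X,Y)$ is the maximum size of an induced matching of $J$ all of whose edges have one endpoint in $X$ and one in $Y$. -}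

module Defs where

open import Data.Nat using (ℕ; zero; suc; _<_; _⊔_)
open import Data.Fin using (Fin; zero; suc; inject₁; fromℕ<)
open import Data.Fin.Subset using (Subset; _∈_; ∁)
open import Data.Product using (_×_; _,_; proj₁; proj₂)
open import Data.Sum using (_⊎_)
open import Data.List using (List; length; lookup)
open import Data.Empty using (⊥)
open import Relation.Nullary using (¬_)
open import Relation.Binary.PropositionalEquality using (_≡_; _≢_)
open import Function.Definitions using (Injective)

record Graph (n : ℕ) : Set₁ where
  field
    Adj   : Fin n → Fin n → Set
    sym   : ∀ {u v} → Adj u v → Adj v u
    irrefl : ∀ {u} → ¬ Adj u u
open Graph public

Edge : ℕ → Set
Edge n = Fin n × Fin n

record Path {n : ℕ} (J : Graph n) : Set where
  field
    nEdges : ℕ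
    vert   : Fin (suc nEdges) → Fin n
    inj    : Injective _≡_ _≡_ vert
    adj    : ∀ (ℓ : Fin nEdges) → Adj J (vert (inject₁ ℓ)) (vert (suc ℓ))
open Path public

size : ∀ {n} {J : Graph n} → Path J → ℕ
size P = suc (nEdges P)

-- The (ℓ+1)-th edge of P (0-indexed ℓ), i.e. the paper's ℓ'-th edge with ℓ' = ℓ + 1.
edgeAt : ∀ {n} {J : Graph n} (P : Path J) (ℓ : ℕ) → ℓ < nEdges P → Edge n
edgeAt P ℓ lt = vert P (inject₁ (fromℕ< lt)) , vert P (suc (fromℕ< lt))

Touch : ∀ {n} → Graph n → Fin n → Fin n → Set
Touch J x y = x ≡ y ⊎ Adj J x y

Separated : ∀ {n} → Graph n → Edge n → Edge n → Set
Separated J (a , b) (c , d) =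
  ¬ Touch J a c × ¬ Touch J a d × ¬ Touch J b c × ¬ Touch J b d

-- An induced matching of J, given as a list of its edges (size = length):
-- every listed pair is an edge of J, and edges at distinct positions are
-- vertex-disjoint with no edge of J between them.
InducedMatching : ∀ {n} → Graph n → List (Edge n) → Set
InducedMatching J M =
  (∀ i → Adj J (proj₁ (lookup M i)) (proj₂ (lookup M i))) ×
  (∀ i j → i ≢ j → Separated J (lookup M i) (lookup M j))

Crosses : ∀ {n} → Subset n → Subset n → Edge n → Set
Crosses X Y (a , b) = (a ∈ X × b ∈ Y) ⊎ (a ∈ Y × b ∈ X)

-- sim_J(X,Y) ≤ t : every induced matching of J all of whose edges go
-- between X and Y has at most t edges (sim is the maximum of these sizes).
SimAtMost : ∀ {n} → Graph n → Subset n → Subset n → ℕ → Set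
SimAtMost J X Y t =
  ∀ (M : List (Edge _)) → InducedMatching J M →
  (∀ i → Crosses X Y (lookup M i)) → length M Data.Nat.≤ t

-- maximum of f over Fin k (0 if k = 0)
maxFin : (k : ℕ) → (Fin k → ℕ) → ℕ
maxFin zero f = 0
maxFin (suc k) f = f zero ⊔ maxFin k (λ i → f (suc i))

VertsIn : ∀ {n} {J : Graph n} → Path J → Subset n → Set
VertsIn P X = ∀ v → vert P v ∈ X

{-# OPTIONS --safe #-}
-- If no path lies inside one side of the cut, every path P_i has a crossing
-- edge, say its ℓ_i-th one, with ℓ_i < max |V(P_j)|.  For each level ℓ the
-- crossing edges of the paths with ℓ_i = ℓ all sit at the same position, so by
-- hypothesis they are pairwise separated and form an induced matching across
-- the cut: at most t paths share a level.  Summing over the levels gives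
-- k ≤ t · max |V(P_j)|.
module Submission where

open import Defs
open import Data.Nat using (ℕ; _<_; _*_)
open import Data.Fin using (Fin)
open import Data.Fin.Subset using (Subset; ∁)
open import Data.List using (_∷_; [])
open import Data.Product using (∃)
open import Data.Sum using (_⊎_)
open import Relation.Binary.PropositionalEquality using (_≢_)

open import Data.Nat using (zero; suc; _+_; _≤_; _≟_; z≤n; s≤s; s≤s⁻¹)
open import Data.Nat.Properties
  using ( m≤m⊔n; m≤n⊔m; ≤-trans; <-≤-trans; +-suc; +-mono-≤; *-suc; m<n⇒m<1+n; n≮0; ≤∧≢⇒<; <⇒≱
        ; module ≤-Reasoning)
open import Data.Fin using (zero; suc; inject₁; fromℕ<)
open import Data.Fin.Properties using (any?; all?)
open import Data.Fin.Subset using (_∈_)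
open import Data.Fin.Subset.Properties using (_∈?_; x∉p⇒x∈∁p)
open import Data.List using (List; length; lookup; filter; map; allFin)
open import Data.List.Properties using (length-map; length-tabulate)
open import Data.List.Membership.Propositional using () renaming (_∈_ to _∈ₗ_)
open import Data.List.Membership.Propositional.Properties using (∈-filter⁻)
open import Data.List.Relation.Unary.Any using (here; there)
open import Data.List.Relation.Unary.AllPairs using (_∷_)
import Data.List.Relation.Unary.All as All
open import Data.List.Relation.Unary.Unique.Propositional using (Unique)
open import Data.List.Relation.Unary.Unique.Propositional.Properties as Unique using (allFin⁺)
open import Data.List.Relation.Binary.Sublist.Propositional.Properties
  using (filter⁺; filter-⊆)
open import Data.List.Relation.Binary.Sublist.Heterogeneous.Properties using (length-mono-≤)
open import Data.Product using (∃₂; _,_; proj₁; proj₂)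
open import Data.Sum using (inj₁; inj₂; fromInj₂)
open import Data.Empty using (⊥-elim)
open import Relation.Nullary using (¬_; yes; no; contradiction; _⊎-dec_; Dec)
open import Relation.Unary using (Decidable)
open import Relation.Unary.Properties using (∁?)
open import Relation.Binary.PropositionalEquality
  using (_≡_; refl; trans; subst; cong; ≢-sym) renaming (sym to ≡-sym)
open import Function using (_∘_; id)

private
  variable
    X B : Set
    n : ℕ

length-filter+length-filter-∁ : ∀ {P : X → Set} (P? : Decidable P) (xs : List X) →
  length (filter P? xs) + length (filter (∁? P?) xs) ≡ length xs
length-filter+length-filter-∁ P? [] = refl
length-filter+length-filter-∁ P? (x ∷ xs) with P? x
... | yes _ = cong suc (length-filter+length-filter-∁ P? xs)
... | no _  = trans (+-suc _ _) (cong suc (length-filter+length-filter-∁ P? xs))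

lookup-map⁺ : ∀ (R : B → Set) (e : X → B) {xs : List X} →
  (∀ {x} → x ∈ₗ xs → R (e x)) → ∀ i → R (lookup (map e xs) i)
lookup-map⁺ R e {x ∷ xs} r zero    = r (here refl)
lookup-map⁺ R e {x ∷ xs} r (suc i) = lookup-map⁺ R e (r ∘ there) i

fibres≤t⇒length≤t*m : ∀ {X : Set} (c : X → ℕ) (t m : ℕ) (xs : List X) →
  (∀ {x} → x ∈ₗ xs → c x < m) →
  (∀ ℓ → length (filter (λ x → c x ≟ ℓ) xs) ≤ t) →
  length xs ≤ t * m
fibres≤t⇒length≤t*m c t zero [] _ _ = z≤n
fibres≤t⇒length≤t*m c t zero (x ∷ xs) c<0 _ = contradiction (c<0 (here refl)) n≮0
fibres≤t⇒length≤t*m {X} c t (suc m) xs c<1+m fibres≤t = begin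
  length xs                                    ≡⟨ length-filter+length-filter-∁ top? xs ⟨
  length (filter top? xs) + length rest        ≤⟨ +-mono-≤ (fibres≤t m) rest≤t*m ⟩
  t + t * m                                    ≡⟨ *-suc t m ⟨
  t * suc m                                    ∎
  where
  open ≤-Reasoning
  top? : Decidable (λ x → c x ≡ m)
  top? x = c x ≟ m
  rest : List X
  rest = filter (∁? top?) xs
  c<m : ∀ {x} → x ∈ₗ rest → c x < m
  c<m x∈rest with x∈xs , cx≢m ← ∈-filter⁻ (∁? top?) x∈rest =
    ≤∧≢⇒< (s≤s⁻¹ (c<1+m x∈xs)) cx≢m
  rest-fibres≤t : ∀ ℓ → length (filter (λ x → c x ≟ ℓ) rest) ≤ t
  rest-fibres≤t ℓ = ≤-trans
    (length-mono-≤ (filter⁺ (λ x → c x ≟ ℓ) (λ x → c x ≟ ℓ) (λ { refl → id })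
                            (filter-⊆ (∁? top?) xs)))
    (fibres≤t ℓ)
  rest≤t*m : length rest ≤ t * m
  rest≤t*m = fibres≤t⇒length≤t*m c t m rest c<m rest-fibres≤t

f≤maxFin : ∀ k (f : Fin k → ℕ) i → f i ≤ maxFin k f
f≤maxFin (suc k) f zero    = m≤m⊔n _ _
f≤maxFin (suc k) f (suc i) = ≤-trans (f≤maxFin k (f ∘ suc) i) (m≤n⊔m _ _)

inducedMatching-map : ∀ (J : Graph n) (e : X → Edge n) {xs : List X} → Unique xs →
  (∀ {x} → x ∈ₗ xs → Adj J (proj₁ (e x)) (proj₂ (e x))) →
  (∀ {x y} → x ∈ₗ xs → y ∈ₗ xs → x ≢ y → Separated J (e x) (e y)) →
  InducedMatching J (map e xs)
inducedMatching-map J e {[]} _ _ _ = (λ ()) , λ ()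
inducedMatching-map J e {x ∷ xs} (x∉xs ∷ unique) isEdge separated =
  lookup-map⁺ IsEdge e isEdge , separated-at
  where
  IsEdge : Edge _ → Set
  IsEdge (a , b) = Adj J a b
  tail : InducedMatching J (map e xs)
  tail = inducedMatching-map J e unique (isEdge ∘ there)
    (λ y∈ z∈ → separated (there y∈) (there z∈))
  separated-at : ∀ i j → i ≢ j →
    Separated J (lookup (map e (x ∷ xs)) i) (lookup (map e (x ∷ xs)) j)
  separated-at zero    zero    i≢j = contradiction refl i≢j
  separated-at zero    (suc j) _   =
    lookup-map⁺ (Separated J (e x)) e
      (λ y∈ → separated (here refl) (there y∈) (All.lookup x∉xs y∈)) j
  separated-at (suc i) zero    _   =
    lookup-map⁺ (λ f → Separated J f (e x)) e
      (λ y∈ → separated (there y∈) (here refl) (≢-sym (All.lookup x∉xs y∈))) i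
  separated-at (suc i) (suc j) i≢j = proj₂ tail i j (i≢j ∘ cong suc)

module _ {n : ℕ} (A : Subset n) where

  CrossingStep : ∀ {m} → (Fin (suc m) → Fin n) → Set
  CrossingStep {m} f =
    ∃₂ λ ℓ (ℓ<m : ℓ < m) → Crosses A (∁ A) (f (inject₁ (fromℕ< ℓ<m)) , f (suc (fromℕ< ℓ<m)))

  oneSided⊎crossingStep : ∀ {m} (f : Fin (suc m) → Fin n) →
    ((∀ v → f v ∈ A) ⊎ (∀ v → f v ∈ ∁ A)) ⊎ CrossingStep f
  oneSided⊎crossingStep {zero} f with f zero ∈? A
  ... | yes f₀∈A = inj₁ (inj₁ λ { zero → f₀∈A })
  ... | no  f₀∉A = inj₁ (inj₂ λ { zero → x∉p⇒x∈∁p f₀∉A })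
  oneSided⊎crossingStep {suc m} f with oneSided⊎crossingStep (f ∘ suc) | f zero ∈? A
  ... | inj₂ (ℓ , ℓ<m , crosses) | _ = inj₂ (suc ℓ , s≤s ℓ<m , crosses)
  ... | inj₁ (inj₁ rest∈A)  | yes f₀∈A =
    inj₁ (inj₁ λ { zero → f₀∈A ; (suc v) → rest∈A v })
  ... | inj₁ (inj₁ rest∈A)  | no  f₀∉A =
    inj₂ (0 , s≤s z≤n , inj₂ (x∉p⇒x∈∁p f₀∉A , rest∈A zero))
  ... | inj₁ (inj₂ rest∈∁A) | yes f₀∈A =
    inj₂ (0 , s≤s z≤n , inj₁ (f₀∈A , rest∈∁A zero))
  ... | inj₁ (inj₂ rest∈∁A) | no  f₀∉A =
    inj₁ (inj₂ λ { zero → x∉p⇒x∈∁p f₀∉A ; (suc v) → rest∈∁A v })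

  module _ {J : Graph n} where

    OneSided : Path J → Set
    OneSided P = VertsIn P A ⊎ VertsIn P (∁ A)

    oneSided? : (P : Path J) → Dec (OneSided P)
    oneSided? P = all? (λ v → vert P v ∈? A) ⊎-dec all? (λ v → vert P v ∈? ∁ A)

    CrossingEdge : Path J → Set
    CrossingEdge P = CrossingStep (vert P)

    ¬oneSided⇒crossingEdge : (P : Path J) → ¬ OneSided P → CrossingEdge P
    ¬oneSided⇒crossingEdge P ¬oneSided =
      fromInj₂ (⊥-elim ∘ ¬oneSided) (oneSided⊎crossingStep (vert P))

    LevelwiseInduced : ∀ {k} → (Fin k → Path J) → Set
    LevelwiseInduced {k} P =
      ∀ (i j : Fin k) → i ≢ j → ∀ (ℓ : ℕ) (li : ℓ < nEdges (P i)) (lj : ℓ < nEdges (P j)) →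
        InducedMatching J (edgeAt (P i) ℓ li ∷ edgeAt (P j) ℓ lj ∷ [])

    levelwiseInduced⇒separated : ∀ {k} {P : Fin k → Path J} → LevelwiseInduced P →
      ∀ {i j} → i ≢ j → ∀ {ℓ ℓ′} (li : ℓ < nEdges (P i)) (lj : ℓ′ < nEdges (P j)) → ℓ ≡ ℓ′ →
      Separated J (edgeAt (P i) ℓ li) (edgeAt (P j) ℓ′ lj)
    levelwiseInduced⇒separated H i≢j li lj refl = proj₂ (H _ _ i≢j _ li lj) zero (suc zero) λ ()

    crossingPaths≤t*maxSize : ∀ {t k} (P : Fin k → Path J) → LevelwiseInduced P →
      SimAtMost J A (∁ A) t → (∀ i → CrossingEdge (P i)) →
      k ≤ t * maxFin k (size ∘ P)
    crossingPaths≤t*maxSize {t} {k} P H sim crossing =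
      subst (_≤ t * maxFin k (size ∘ P)) (length-tabulate id)
        (fibres≤t⇒length≤t*m level t _ (allFin k) (λ {i} _ → level<maxSize i) fibre≤t)
      where
      level : Fin k → ℕ
      level i = proj₁ (crossing i)
      level<nEdges : ∀ i → level i < nEdges (P i)
      level<nEdges i = proj₁ (proj₂ (crossing i))
      level<maxSize : ∀ i → level i < maxFin k (size ∘ P)
      level<maxSize i = <-≤-trans (m<n⇒m<1+n (level<nEdges i)) (f≤maxFin k (size ∘ P) i)
      edge : Fin k → Edge n
      edge i = edgeAt (P i) (level i) (level<nEdges i)
      atLevel? : ∀ ℓ → Decidable (λ i → level i ≡ ℓ)
      atLevel? ℓ i = level i ≟ ℓ
      fibre≤t : ∀ ℓ → length (filter (atLevel? ℓ) (allFin k)) ≤ t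
      fibre≤t ℓ = subst (_≤ t) (length-map edge fibre) (sim (map edge fibre) matching crosses)
        where
        fibre : List (Fin k)
        fibre = filter (atLevel? ℓ) (allFin k)
        fibre-level : ∀ {i} → i ∈ₗ fibre → level i ≡ ℓ
        fibre-level = proj₂ ∘ ∈-filter⁻ (atLevel? ℓ) {xs = allFin k}
        separated : ∀ {i j} → i ∈ₗ fibre → j ∈ₗ fibre → i ≢ j → Separated J (edge i) (edge j)
        separated {i} {j} i∈ j∈ i≢j = levelwiseInduced⇒separated {P = P} H i≢j
          (level<nEdges i) (level<nEdges j) (trans (fibre-level i∈) (≡-sym (fibre-level j∈)))
        matching : InducedMatching J (map edge fibre)
        matching = inducedMatching-map J edge (Unique.filter⁺ (atLevel? ℓ) (allFin⁺ k))
          (λ {i} _ → adj (P i) (fromℕ< (level<nEdges i))) separated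
        crosses : ∀ i → Crosses A (∁ A) (lookup (map edge fibre) i)
        crosses = lookup-map⁺ (Crosses A (∁ A)) edge {fibre}
          (λ {i} _ → proj₂ (proj₂ (crossing i)))

lemma27 : ∀ {n : ℕ} (J : Graph n) (t k : ℕ) (P : Fin k → Path J) →
  t * maxFin k (λ i → size (P i)) < k →
  (∀ (i j : Fin k) → i ≢ j → ∀ (ℓ : ℕ) (li : ℓ < nEdges (P i)) (lj : ℓ < nEdges (P j)) →
    InducedMatching J (edgeAt (P i) ℓ li ∷ edgeAt (P j) ℓ lj ∷ [])) →
  ∀ (A : Subset n) → SimAtMost J A (∁ A) t →
  ∃ λ (i : Fin k) → VertsIn (P i) A ⊎ VertsIn (P i) (∁ A)
lemma27 J t k P bound H A sim with any? (λ i → oneSided? A (P i))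
... | yes oneSided = oneSided
... | no ¬oneSided = contradiction (crossingPaths≤t*maxSize A P H sim crossing) (<⇒≱ bound)
  where
  crossing : ∀ i → CrossingEdge A (P i)
  crossing i = ¬oneSided⇒crossingEdge A (P i) (¬oneSided ∘ (i ,_))
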